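{- Let $p$ be a prime and $N$ an integer with $p^2>N\ge1$. The linear complexity $L_p(N)$ of the sequence $q_p(u)$, $u=0,\ldots,N-1$ (regarded as a sequence of elements of $\mathbb F_p$), satisfies $$L_p(N)\ge\frac12\min\{p-1,\,N-p-1\}.$$
   Context: For a prime $p$ and an integer $u$ with $\gcd(u,p)=1$, the Fermat quotient $q_p(u)$ is the unique integer with $q_p(u)\equiv (u^{p-1}-1)/p \pmod p$ and $0\le q_p(u)\le p-1$; also $q_p(kp)=0$ for all $k\in\mathbb Z$. The linear complexity of an $N$-element sequence $s_0,\ldots,s_{N-1}$ in a ring $\mathcal R$ is the smallest integer $L\ge0$ such that there exist $c_0,\ldots,c_{L-1}\in\mathcal R$ with $s_{u+L}=c_{L-1}s_{u+L-1}+\cdots+c_0s_u$ for all $0\le u\le N-L-1$. -}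

module Defs where

open import Data.Nat using (ℕ; zero; suc; _+_; _*_; _∸_; _^_; _<_; _≡ᵇ_)
open import Data.Nat.DivMod using (_/_; _%_)
open import Data.Bool using (if_then_else_)
open import Data.Product using (∃-syntax; Σ-syntax)
open import Relation.Binary.PropositionalEquality using (_≡_)

-- Fermat quotient q_p(u) ∈ {0,…,p-1}:
--   q_p(u) = ((u^(p-1) - 1) / p) mod p  if p ∤ u,   q_p(u) = 0 if p ∣ u.
-- (For p ∤ u, p ∣ u^(p-1) - 1 by Fermat, so the division is exact;
--  the modulus-0 case is a dummy value and is never used for primes.)
fermatQuotient : ℕ → ℕ → ℕ
fermatQuotient zero    u = 0
fermatQuotient (suc k) u =
  if (u % suc k) ≡ᵇ 0
    then 0
    else ((u ^ k ∸ 1) / suc k) % suc k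

-- congruence modulo m (elements of F_p represented by naturals)
_≡_[mod_] : ℕ → ℕ → ℕ → Set
a ≡ b [mod m ] = ∃[ x ] ∃[ y ] a + x * m ≡ b + y * m

linComb : (L : ℕ) → (ℕ → ℕ) → (ℕ → ℕ) → ℕ → ℕ
linComb zero    c s u = 0
linComb (suc L) c s u = linComb L c s u + c L * s (u + L)

HasLinRec : (p : ℕ) → (s : ℕ → ℕ) → (N L : ℕ) → Set
HasLinRec p s N L =
  Σ[ c ∈ (ℕ → ℕ) ] (∀ u → u + L < N → s (u + L) ≡ linComb L c s u [mod p ])

IsLinearComplexity : (p : ℕ) → (s : ℕ → ℕ) → (N L : ℕ) → Set
IsLinearComplexity p s N L =
  HasLinRec p s N L × (∀ L' → L' < L → HasLinRec p s N L' → ⊥)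
  where
    open import Data.Product using (_×_)
    open import Data.Empty using (⊥)

-- Write q = q_p.  If p ∤ u, Fermat's little theorem makes u^(p-1) - 1 divisible by p, and expanding
-- (u + p)^(p-1) modulo p² gives u (q(u + p) - q(u)) ≡ -1 (mod p).  Suppose q satisfied a recurrence
-- q(u + L) = ∑_{m < L} c_m q(u + m) with 2L < p - 1 and 2L < N - p - 1.  Subtracting it at u = x from
-- the one at u = x + p yields ∑_{m ≤ L} c_m / (x + m) ≡ 0 (mod p), with c_L = -1, for x = 1, …, L + 1.
-- Clearing denominators, a polynomial of degree at most L has L + 1 roots modulo p and therefore
-- vanishes identically; but at x = p - L it equals ∏_{m < L} (p - L + m), which is prime to p.

module Submission where

open import Data.Empty using (⊥-elim)
open import Data.Product using (∃-syntax; _×_; _,_)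
open import Data.Sum using (_⊎_; inj₁; inj₂)
open import Relation.Nullary using (¬_; yes; no)
open import Relation.Binary.PropositionalEquality
open import Function using (_∘_)
open import Data.Nat.Primality using (Prime; euclidsLemma; ¬prime[0]; ¬prime[1])
open import Data.Nat using (ℕ; zero; suc)
open import Defs

module _ where
  open import Data.Nat
  open import Data.Nat.Properties
  open import Data.Nat.Divisibility
  open import Data.Nat.DivMod using (m/n*n≡m; m*n/n≡m; m≡m%n+[m/n]*n)
  open import Data.Nat.Combinatorics
  open import Data.Nat.Tactic.RingSolver
  open import Data.List using (_∷_; [])
  open ≡-Reasoning

  sumBelow : ℕ → (ℕ → ℕ) → ℕ
  sumBelow zero    f = 0
  sumBelow (suc n) f = sumBelow n f + f n

  syntax sumBelow n (λ i → e) = ∑[ i < n ] e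

  ∑-cong : ∀ n {f g : ℕ → ℕ} → (∀ i → f i ≡ g i) → ∑[ i < n ] f i ≡ ∑[ i < n ] g i
  ∑-cong zero    f≗g = refl
  ∑-cong (suc n) f≗g = cong₂ _+_ (∑-cong n f≗g) (f≗g n)

  ∑-distrib-+ : ∀ n (f g : ℕ → ℕ) → ∑[ i < n ] (f i + g i) ≡ ∑[ i < n ] f i + ∑[ i < n ] g i
  ∑-distrib-+ zero    f g = refl
  ∑-distrib-+ (suc n) f g = begin
    ∑[ i < n ] (f i + g i) + (f n + g n)            ≡⟨ cong (_+ (f n + g n)) (∑-distrib-+ n f g) ⟩
    ∑[ i < n ] f i + ∑[ i < n ] g i + (f n + g n)   ≡⟨ +-+-comm (∑[ i < n ] f i) _ (f n) (g n) ⟩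
    ∑[ i < n ] f i + f n + (∑[ i < n ] g i + g n)   ∎
    where
      +-+-comm : ∀ a b c d → a + b + (c + d) ≡ a + c + (b + d)
      +-+-comm = solve-∀

  *-distribˡ-∑ : ∀ n a (f : ℕ → ℕ) → a * ∑[ i < n ] f i ≡ ∑[ i < n ] (a * f i)
  *-distribˡ-∑ zero    a f = *-zeroʳ a
  *-distribˡ-∑ (suc n) a f =
    trans (*-distribˡ-+ a (∑[ i < n ] f i) (f n)) (cong (_+ a * f n) (*-distribˡ-∑ n a f))

  ∑-head : ∀ n (f : ℕ → ℕ) → ∑[ i < suc n ] f i ≡ f 0 + ∑[ i < n ] f (suc i)
  ∑-head zero    f = +-comm 0 (f 0)
  ∑-head (suc n) f = trans (cong (_+ f (suc n)) (∑-head n f)) (+-assoc (f 0) _ _)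

  ∑-∣ : ∀ {d} n (f : ℕ → ℕ) → (∀ i → i < n → d ∣ f i) → d ∣ ∑[ i < n ] f i
  ∑-∣ zero    f d∣f = _ ∣0
  ∑-∣ (suc n) f d∣f = ∣m∣n⇒∣m+n (∑-∣ n f (λ i i<n → d∣f i (m<n⇒m<1+n i<n))) (d∣f n ≤-refl)

  binomial-theorem : ∀ n x → (1 + x) ^ n ≡ ∑[ k < suc n ] ((n C k) * x ^ k)
  binomial-theorem zero    x = refl
  binomial-theorem (suc n) x = begin
    (1 + x) * (1 + x) ^ n   ≡⟨ cong ((1 + x) *_) (binomial-theorem n x) ⟩
    (1 + x) * B n           ≡⟨ *-distribʳ-+ (B n) 1 x ⟩
    1 * B n + x * B n       ≡⟨ cong (_+ x * B n) (*-identityˡ (B n)) ⟩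
    B n + x * B n           ≡⟨ pascal ⟨
    B (suc n)               ∎
    where
      term : ℕ → ℕ → ℕ
      term m k = (m C k) * x ^ k
      B : ℕ → ℕ
      B m = ∑[ k < suc m ] term m k
      shifted : ℕ
      shifted = ∑[ i < suc n ] term n (suc i)
      regroup : ∀ a b y z → (a + b) * (y * z) ≡ y * (a * z) + b * (y * z)
      regroup = solve-∀
      rotate : ∀ a b c → a + (b + c) ≡ (a + c) + b
      rotate = solve-∀
      pascal-term : ∀ i → term (suc n) (suc i) ≡ x * term n i + term n (suc i)
      pascal-term i = begin
        (suc n C suc i) * x ^ suc i         ≡⟨ cong (_* x ^ suc i) (nCk+nC[k+1]≡[n+1]C[k+1] n i) ⟨
        (n C i + n C suc i) * (x * x ^ i)   ≡⟨ regroup (n C i) (n C suc i) x (x ^ i) ⟩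
        x * term n i + term n (suc i)       ∎
      last-vanishes : B n + term n (suc n) ≡ B n
      last-vanishes = trans (cong (λ c → B n + c * x ^ suc n) (k>n⇒nCk≡0 (n<1+n n))) (+-identityʳ (B n))
      pascal : B (suc n) ≡ B n + x * B n
      pascal = begin
        B (suc n)                                                  ≡⟨ ∑-head (suc n) _ ⟩
        1 + ∑[ i < suc n ] term (suc n) (suc i)                    ≡⟨ cong (1 +_) (∑-cong (suc n) pascal-term) ⟩
        1 + ∑[ i < suc n ] (x * term n i + term n (suc i))         ≡⟨ cong (1 +_) (∑-distrib-+ (suc n) _ _) ⟩
        1 + (∑[ i < suc n ] (x * term n i) + shifted)              ≡⟨ cong (λ s → 1 + (s + shifted)) (*-distribˡ-∑ (suc n) x _) ⟨
        1 + (x * B n + shifted)                                    ≡⟨ rotate 1 (x * B n) shifted ⟩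
        (1 + shifted) + x * B n                                    ≡⟨ cong (_+ x * B n) (∑-head (suc n) _) ⟨
        (B n + term n (suc n)) + x * B n                           ≡⟨ cong (_+ x * B n) last-vanishes ⟩
        B n + x * B n                                              ∎

  p∤m! : ∀ {p m} → Prime p → m < p → ¬ p ∣ m !
  p∤m! {m = zero}  p-prime _   p∣1   = ¬prime[1] (subst Prime (∣1⇒≡1 p∣1) p-prime)
  p∤m! {m = suc m} p-prime m<p p∣m! with euclidsLemma (suc m) (m !) p-prime p∣m!
  ... | inj₁ p∣m+1 = <⇒≱ m<p (∣⇒≤ p∣m+1)
  ... | inj₂ p∣m!′ = p∤m! p-prime (<-trans (n<1+n m) m<p) p∣m!′

  nCk*k![n∸k]!≡n! : ∀ {n k} → k ≤ n → (n C k) * (k ! * (n ∸ k) !) ≡ n !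
  nCk*k![n∸k]!≡n! {n} {k} k≤n = trans (cong (_* (k ! * (n ∸ k) !)) (nCk≡n!/k![n-k]! k≤n))
                              (m/n*n≡m {{k !* (n ∸ k) !≢0}} (k![n∸k]!∣n! k≤n))

  p∣pCk : ∀ {p k} → Prime p → 0 < k → k < p → p ∣ p C k
  p∣pCk {suc n} {k} p-prime 0<k k<p
    with euclidsLemma (suc n C k) (k ! * (suc n ∸ k) !) p-prime
           (subst (suc n ∣_) (sym (nCk*k![n∸k]!≡n! (<⇒≤ k<p))) (m∣m*n (n !)))
  ... | inj₁ p∣C = p∣C
  ... | inj₂ p∣!*! with euclidsLemma (k !) ((suc n ∸ k) !) p-prime p∣!*!
  ...   | inj₁ p∣k!     = ⊥-elim (p∤m! p-prime k<p p∣k!)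
  ...   | inj₂ p∣[p-k]! = ⊥-elim (p∤m! p-prime (∸-monoʳ-< 0<k (<⇒≤ k<p)) p∣[p-k]!)

  [1+x]^p≡1+x^p : ∀ {p} → Prime p → ∀ x → ((1 + x) ^ p) ≡ (1 + x ^ p) [mod p ]
  [1+x]^p≡1+x^p {suc n} p-prime x = 0 , m , (begin
    (1 + x) ^ suc n + 0                           ≡⟨ +-identityʳ _ ⟩
    (1 + x) ^ suc n                               ≡⟨ binomial-theorem (suc n) x ⟩
    ∑[ k < suc (suc n) ] ((suc n C k) * x ^ k)    ≡⟨ ∑-head (suc n) _ ⟩
    1 + (middle + (suc n C suc n) * x ^ suc n)    ≡⟨ cong (λ c → 1 + (middle + c * x ^ suc n)) (nCn≡1 (suc n)) ⟩
    1 + (middle + 1 * x ^ suc n)                  ≡⟨ rearrange middle (x ^ suc n) ⟩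
    1 + x ^ suc n + middle                        ≡⟨ cong (1 + x ^ suc n +_) middle≡m*p ⟩
    1 + x ^ suc n + m * suc n                     ∎)
    where
      middle : ℕ
      middle = ∑[ i < n ] ((suc n C suc i) * x ^ suc i)
      p∣middle : suc n ∣ middle
      p∣middle = ∑-∣ n _ (λ i i<n → ∣m⇒∣m*n (x ^ suc i) (p∣pCk p-prime (s≤s z≤n) (s≤s i<n)))
      open _∣_ p∣middle renaming (quotient to m; equality to middle≡m*p)
      rearrange : ∀ a b → 1 + (a + 1 * b) ≡ 1 + b + a
      rearrange = solve-∀

  binomial-mod-square : ∀ u m n → ∃[ T ] u * (u + m) ^ n ≡ (u + n * m) * u ^ n + T * (m * m)
  binomial-mod-square u m zero    = 0 , solve (u ∷ m ∷ [])
  binomial-mod-square u m (suc n) with binomial-mod-square u m n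
  ... | T , eq = n * u ^ n + (u + m) * T , (begin
    u * ((u + m) * (u + m) ^ n)                                           ≡⟨ swap u (u + m) ((u + m) ^ n) ⟩
    (u + m) * (u * (u + m) ^ n)                                           ≡⟨ cong ((u + m) *_) eq ⟩
    (u + m) * ((u + n * m) * u ^ n + T * (m * m))                         ≡⟨ expand u m n (u ^ n) T ⟩
    (u + suc n * m) * (u * u ^ n) + (n * u ^ n + (u + m) * T) * (m * m)   ∎)
    where
      swap : ∀ a b c → a * (b * c) ≡ b * (a * c)
      swap = solve-∀
      expand : ∀ u m n w T → (u + m) * ((u + n * m) * w + T * (m * m))
                           ≡ (u + (1 + n) * m) * (u * w) + (n * w + (u + m) * T) * (m * m)
      expand = solve-∀

  -- Multiply (u + p) ^ k = 1 + Q′ p by u, expand modulo p², cancel one factor p and use k + 1 = p.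
  exact-quotient-shift : ∀ k u Q Q′ → u ^ k ≡ 1 + Q * suc k → (u + suc k) ^ k ≡ 1 + Q′ * suc k →
                         (u * Q′ + 1) ≡ (u * Q) [mod suc k ]
  exact-quotient-shift k u Q Q′ u^k≡ [u+p]^k≡ with binomial-mod-square u (suc k) k
  ... | T , binomial = 0 , 1 + k * Q + T , (begin
    u * Q′ + 1 + 0 * p                ≡⟨ +-identityʳ (u * Q′ + 1) ⟩
    u * Q′ + 1                        ≡⟨ cong (_+ 1) uQ′≡ ⟩
    k + u * Q + (k * Q + T) * p + 1   ≡⟨ regroup k u Q T ⟩
    u * Q + (1 + k * Q + T) * p       ∎)
    where
      p : ℕ
      p = suc k
      factor-u : ∀ u Q p → u + u * Q * p ≡ u * (1 + Q * p)
      factor-u = solve-∀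
      expand : ∀ u k p Q T → (u + k * p) * (1 + Q * p) + T * (p * p) ≡ u + (k + u * Q + (k * Q + T) * p) * p
      expand = solve-∀
      regroup : ∀ k u Q T → k + u * Q + (k * Q + T) * (1 + k) + 1 ≡ u * Q + (1 + k * Q + T) * (1 + k)
      regroup = solve-∀
      cancelled : u + u * Q′ * p ≡ u + (k + u * Q + (k * Q + T) * p) * p
      cancelled = begin
        u + u * Q′ * p                            ≡⟨ factor-u u Q′ p ⟩
        u * (1 + Q′ * p)                          ≡⟨ cong (u *_) [u+p]^k≡ ⟨
        u * (u + p) ^ k                           ≡⟨ binomial ⟩
        (u + k * p) * u ^ k + T * (p * p)         ≡⟨ cong (λ w → (u + k * p) * w + T * (p * p)) u^k≡ ⟩
        (u + k * p) * (1 + Q * p) + T * (p * p)   ≡⟨ expand u k p Q T ⟩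
        u + (k + u * Q + (k * Q + T) * p) * p     ∎
      uQ′≡ : u * Q′ ≡ k + u * Q + (k * Q + T) * p
      uQ′≡ = *-cancelʳ-≡ (u * Q′) _ p (+-cancelˡ-≡ u _ _ cancelled)

  exact-quotient≡fermatQuotient : ∀ k u m → ¬ suc k ∣ u → u ^ k ≡ 1 + m * suc k →
                                  m ≡ fermatQuotient (suc k) u [mod suc k ]
  exact-quotient≡fermatQuotient k u m p∤u u^k≡ with u % suc k in u%p≡
  ... | zero  = ⊥-elim (p∤u (m%n≡0⇒n∣m u (suc k) u%p≡))
  ... | suc _ = 0 , m / p , (begin
    m + 0 * p                         ≡⟨ +-identityʳ m ⟩
    m                                 ≡⟨ m≡m%n+[m/n]*n m p ⟩
    m % p + m / p * p                 ≡⟨ cong (λ w → w % p + m / p * p) (m*n/n≡m m p) ⟨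
    m * p / p % p + m / p * p         ≡⟨ cong (λ w → w / p % p + m / p * p) u^k-1≡ ⟨
    (u ^ k ∸ 1) / p % p + m / p * p   ∎)
    where
      p : ℕ
      p = suc k
      u^k-1≡ : u ^ k ∸ 1 ≡ m * p
      u^k-1≡ = trans (cong (_∸ 1) u^k≡) (m+n∸m≡n 1 (m * p))

module _ where
  open import Data.Nat as ℕ using (_≤_; _<_; _≟_)
  import Data.Nat.Properties as ℕ
  open import Data.Integer using (ℤ; +_; _+_; _*_; _-_; 0ℤ; 1ℤ)
  open import Data.Integer.Properties using (*-comm; *-assoc; *-zeroʳ; pos-+; pos-*)
  open import Data.Integer.Tactic.RingSolver
  open ≡-Reasoning

  rising : ℕ → ℤ → ℤ
  rising zero    x = 1ℤ
  rising (suc n) x = (x + + n) * rising n x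

  risingWithout : ℕ → ℕ → ℤ → ℤ
  risingWithout zero    i x = 1ℤ
  risingWithout (suc n) i x with n ≟ i
  ... | yes _ = risingWithout n i x
  ... | no _  = (x + + n) * risingWithout n i x

  risingWithout-suc-≢ : ∀ {n i} → n ≢ i → ∀ x → risingWithout (suc n) i x ≡ (x + + n) * risingWithout n i x
  risingWithout-suc-≢ {n} {i} n≢i x with n ≟ i
  ... | yes n≡i = ⊥-elim (n≢i n≡i)
  ... | no _    = refl

  risingWithout-≥ : ∀ {n i} → n ≤ i → ∀ x → risingWithout n i x ≡ rising n x
  risingWithout-≥ {zero}  _   x = refl
  risingWithout-≥ {suc n} n<i x = trans (risingWithout-suc-≢ (ℕ.<⇒≢ n<i) x)
                                        (cong ((x + + n) *_) (risingWithout-≥ (ℕ.<⇒≤ n<i) x))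

  risingWithout-last : ∀ n x → risingWithout (suc n) n x ≡ rising n x
  risingWithout-last n x with n ≟ n
  ... | yes _  = risingWithout-≥ {n} ℕ.≤-refl x
  ... | no n≢n = ⊥-elim (n≢n refl)

  risingWithout-* : ∀ {n i} → i < n → ∀ x → risingWithout n i x * (x + + i) ≡ rising n x
  risingWithout-* {suc n} {i} i<1+n x with n ≟ i
  ... | yes refl = trans (cong (_* (x + + n)) (risingWithout-≥ {n} ℕ.≤-refl x)) (*-comm (rising n x) (x + + n))
  ... | no n≢i   = begin
    (x + + n) * risingWithout n i x * (x + + i)     ≡⟨ *-assoc (x + + n) _ (x + + i) ⟩
    (x + + n) * (risingWithout n i x * (x + + i))   ≡⟨ cong ((x + + n) *_) (risingWithout-* i<n x) ⟩
    (x + + n) * rising n x                          ∎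
    where
      i<n : i < n
      i<n = ℕ.≤∧≢⇒< (ℕ.≤-pred i<1+n) (n≢i ∘ sym)

  linCombℤ : ℕ → (ℕ → ℕ) → (ℕ → ℤ) → ℤ
  linCombℤ zero    c f = 0ℤ
  linCombℤ (suc n) c f = linCombℤ n c f + + c n * f n

  +-linComb : ∀ n c s u → + linComb n c s u ≡ linCombℤ n c (λ i → + s (u ℕ.+ i))
  +-linComb zero    c s u = refl
  +-linComb (suc n) c s u = begin
    + (linComb n c s u ℕ.+ c n ℕ.* s (u ℕ.+ n))                   ≡⟨ pos-+ (linComb n c s u) _ ⟩
    + linComb n c s u + + (c n ℕ.* s (u ℕ.+ n))                   ≡⟨ cong₂ _+_ (+-linComb n c s u) (pos-* (c n) _) ⟩
    linCombℤ n c (λ i → + s (u ℕ.+ i)) + + c n * + s (u ℕ.+ n)    ∎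

  linCombℤ-0 : ∀ n c → linCombℤ n c (λ _ → 0ℤ) ≡ 0ℤ
  linCombℤ-0 zero    c = refl
  linCombℤ-0 (suc n) c = cong₂ _+_ (linCombℤ-0 n c) (*-zeroʳ (+ c n))

  *-distribˡ-linCombℤ-− : ∀ n c a f g →
                          a * (linCombℤ n c f - linCombℤ n c g) ≡ linCombℤ n c (λ i → a * (f i - g i))
  *-distribˡ-linCombℤ-− zero    c a f g = *-zeroʳ a
  *-distribˡ-linCombℤ-− (suc n) c a f g = begin
    a * ((F + + c n * f n) - (G + + c n * g n))                         ≡⟨ distrib a F G (+ c n) (f n) (g n) ⟩
    a * (F - G) + + c n * (a * (f n - g n))                             ≡⟨ cong (_+ + c n * (a * (f n - g n)))
                                                                              (*-distribˡ-linCombℤ-− n c a f g) ⟩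
    linCombℤ n c (λ i → a * (f i - g i)) + + c n * (a * (f n - g n))    ∎
    where
      F G : ℤ
      F = linCombℤ n c f
      G = linCombℤ n c g
      distrib : ∀ a F G c u v → a * ((F + c * u) - (G + c * v)) ≡ a * (F - G) + c * (a * (u - v))
      distrib = solve-∀

module Modulo (p : ℕ) where
  open import Data.Nat as ℕ using (_≤_)
  import Data.Nat.Properties as ℕ
  import Data.Nat.Divisibility as ℕ
  open import Data.Integer using (ℤ; +_; _+_; _*_; _-_; -_; 0ℤ; 1ℤ)
  open import Data.Integer.Properties
  open import Data.Integer.Divisibility.Signed
  open import Data.Integer.Tactic.RingSolver
  open import Relation.Binary.Bundles using (Setoid)

  private
    *-distribˡ-minus : ∀ c a b → c * (a - b) ≡ c * a - c * b
    *-distribˡ-minus = solve-∀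

  infix 4 _≈_
  record _≈_ (a b : ℤ) : Set where
    constructor mk≈
    field p∣difference : + p ∣ a - b

  ≈-refl : ∀ {a} → a ≈ a
  ≈-refl {a} = mk≈ (subst (+ p ∣_) (sym (+-inverseʳ a)) (divides 0ℤ refl))

  ≈-reflexive : ∀ {a b} → a ≡ b → a ≈ b
  ≈-reflexive refl = ≈-refl

  ≈-sym : ∀ {a b} → a ≈ b → b ≈ a
  ≈-sym {a} {b} (mk≈ p∣a-b) = mk≈ (subst (+ p ∣_) (flip a b) (∣m⇒∣-m p∣a-b))
    where
      flip : ∀ a b → - (a - b) ≡ b - a
      flip = solve-∀

  ≈-trans : ∀ {a b c} → a ≈ b → b ≈ c → a ≈ c
  ≈-trans {a} {b} {c} (mk≈ p∣a-b) (mk≈ p∣b-c) =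
    mk≈ (subst (+ p ∣_) (telescope a b c) (∣m∣n⇒∣m+n p∣a-b p∣b-c))
    where
      telescope : ∀ a b c → (a - b) + (b - c) ≡ a - c
      telescope = solve-∀

  ≈-setoid : Setoid _ _
  ≈-setoid = record
    { Carrier       = ℤ
    ; _≈_           = _≈_
    ; isEquivalence = record { refl = ≈-refl ; sym = ≈-sym ; trans = ≈-trans }
    }

  +-cong : ∀ {a b c d} → a ≈ b → c ≈ d → a + c ≈ b + d
  +-cong {a} {b} {c} {d} (mk≈ p∣a-b) (mk≈ p∣c-d) =
    mk≈ (subst (+ p ∣_) (interchange a b c d) (∣m∣n⇒∣m+n p∣a-b p∣c-d))
    where
      interchange : ∀ a b c d → (a - b) + (c - d) ≡ (a + c) - (b + d)
      interchange = solve-∀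

  +-congˡ : ∀ c {a b} → a ≈ b → c + a ≈ c + b
  +-congˡ c = +-cong (≈-refl {c})

  +-congʳ : ∀ c {a b} → a ≈ b → a + c ≈ b + c
  +-congʳ c a≈b = +-cong a≈b (≈-refl {c})

  *-congˡ : ∀ c {a b} → a ≈ b → c * a ≈ c * b
  *-congˡ c {a} {b} (mk≈ p∣a-b) = mk≈ (subst (+ p ∣_) (*-distribˡ-minus c a b) (∣n⇒∣m*n c p∣a-b))

  *-congʳ : ∀ c {a b} → a ≈ b → a * c ≈ b * c
  *-congʳ c {a} {b} a≈b = subst₂ _≈_ (*-comm c a) (*-comm c b) (*-congˡ c a≈b)

  -‿cong : ∀ {a b} → a ≈ b → - a ≈ - b
  -‿cong {a} {b} a≈b = subst₂ _≈_ (-1*i≡-i a) (-1*i≡-i b) (*-congˡ (- 1ℤ) a≈b)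

  ∣⇒≈0 : ∀ {a} → + p ∣ a → a ≈ 0ℤ
  ∣⇒≈0 {a} p∣a = mk≈ (subst (+ p ∣_) (sym (+-identityʳ a)) p∣a)

  ≈0⇒∣ : ∀ {a} → a ≈ 0ℤ → + p ∣ a
  ≈0⇒∣ {a} (mk≈ p∣a-0) = subst (+ p ∣_) (+-identityʳ a) p∣a-0

  p≈0 : + p ≈ 0ℤ
  p≈0 = ∣⇒≈0 ∣-refl

  +-multiple≈ : ∀ a n → a + n * + p ≈ a
  +-multiple≈ a n = mk≈ (subst (+ p ∣_) (sym (cancel a (n * + p))) (∣n⇒∣m*n n ∣-refl))
    where
      cancel : ∀ a b → (a + b) - a ≡ b
      cancel = solve-∀

  open import Relation.Binary.Reasoning.Setoid ≈-setoid

  ≡[mod]⇒≈ : ∀ {a b} → a ≡ b [mod p ] → + a ≈ + b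
  ≡[mod]⇒≈ {a} {b} (x , y , a+xp≡b+yp) = begin
    + a                 ≈⟨ +-multiple≈ (+ a) (+ x) ⟨
    + a + + x * + p     ≡⟨ cast a x ⟨
    + (a ℕ.+ x ℕ.* p)   ≡⟨ cong +_ a+xp≡b+yp ⟩
    + (b ℕ.+ y ℕ.* p)   ≡⟨ cast b y ⟩
    + b + + y * + p     ≈⟨ +-multiple≈ (+ b) (+ y) ⟩
    + b                 ∎
    where
      cast : ∀ a x → + (a ℕ.+ x ℕ.* p) ≡ + a + + x * + p
      cast a x = trans (pos-+ a (x ℕ.* p)) (cong (λ t → + a + t) (pos-* x p))

  ≈⇒≡+multiple : ∀ {a b} → + a ≈ + b → b ≤ a → ∃[ m ] a ≡ b ℕ.+ m ℕ.* p
  ≈⇒≡+multiple {a} {b} (mk≈ p∣a-b) b≤a = m , trans (sym (ℕ.m+[n∸m]≡n b≤a)) (cong (b ℕ.+_) a-b≡m*p)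
    where
      p∣a∸b : p ℕ.∣ a ℕ.∸ b
      p∣a∸b = ∣⇒∣ᵤ (subst (+ p ∣_) (trans (m-n≡m⊖n a b) (⊖-≥ b≤a)) p∣a-b)
      open ℕ._∣_ p∣a∸b renaming (quotient to m; equality to a-b≡m*p)

  linCombℤ-cong : ∀ n c {f g} → (∀ i → i ℕ.< n → f i ≈ g i) → linCombℤ n c f ≈ linCombℤ n c g
  linCombℤ-cong zero    c f≈g = ≈-refl
  linCombℤ-cong (suc n) c f≈g =
    +-cong (linCombℤ-cong n c (λ i i<n → f≈g i (ℕ.m<n⇒m<1+n i<n))) (*-congˡ (+ c n) (f≈g n ℕ.≤-refl))

  module _ (p-prime : Prime p) where

    ∣*⇒∣⊎∣ : ∀ {a b} → + p ∣ a * b → + p ∣ a ⊎ + p ∣ b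
    ∣*⇒∣⊎∣ {a} {b} p∣ab with euclidsLemma _ _ p-prime (subst (p ℕ.∣_) (abs-* a b) (∣⇒∣ᵤ p∣ab))
    ... | inj₁ p∣a = inj₁ (∣ᵤ⇒∣ p∣a)
    ... | inj₂ p∣b = inj₂ (∣ᵤ⇒∣ p∣b)

    *-≉0 : ∀ {a b} → ¬ a ≈ 0ℤ → ¬ b ≈ 0ℤ → ¬ a * b ≈ 0ℤ
    *-≉0 a≉0 b≉0 ab≈0 with ∣*⇒∣⊎∣ (≈0⇒∣ ab≈0)
    ... | inj₁ p∣a = a≉0 (∣⇒≈0 p∣a)
    ... | inj₂ p∣b = b≉0 (∣⇒≈0 p∣b)

    *-cancelˡ-≈ : ∀ c {a b} → ¬ c ≈ 0ℤ → c * a ≈ c * b → a ≈ b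
    *-cancelˡ-≈ c {a} {b} c≉0 (mk≈ p∣ca-cb)
      with ∣*⇒∣⊎∣ (subst (+ p ∣_) (sym (*-distribˡ-minus c a b)) p∣ca-cb)
    ... | inj₁ p∣c   = ⊥-elim (c≉0 (∣⇒≈0 p∣c))
    ... | inj₂ p∣a-b = mk≈ p∣a-b

    positive<p⇒≉0 : ∀ {n} → 0 ℕ.< n → n ℕ.< p → ¬ + n ≈ 0ℤ
    positive<p⇒≉0 {suc n} _ n<p n≈0 = ℕ.<⇒≱ n<p (ℕ.∣⇒≤ (∣⇒∣ᵤ (≈0⇒∣ n≈0)))

    rising-≉0 : ∀ n {x} → (∀ m → m ℕ.< n → ¬ x + + m ≈ 0ℤ) → ¬ rising n x ≈ 0ℤ
    rising-≉0 zero    _       1≈0 = ¬prime[1] (subst Prime (ℕ.∣1⇒≡1 (∣⇒∣ᵤ (≈0⇒∣ 1≈0))) p-prime)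
    rising-≉0 (suc n) factors =
      *-≉0 (factors n ℕ.≤-refl) (rising-≉0 n (λ m m<n → factors m (ℕ.m<n⇒m<1+n m<n)))

module FermatQuotient (k : ℕ) (p-prime : Prime (suc k)) where
  open import Data.Nat as ℕ using (_^_)
  import Data.Nat.Properties as ℕ
  open import Data.Nat.Divisibility using (_∣_; _∣0; ∣-refl; ∣m+n∣m⇒∣n)
  open import Data.Integer using (+_; _+_; _*_; _-_; -_; 1ℤ)
  open import Data.Integer.Properties using (pos-+; pos-*; *-identityʳ)
  open import Data.Integer.Divisibility.Signed using (∣⇒∣ᵤ)
  open import Data.Integer.Tactic.RingSolver
  open Modulo (suc k)
  open import Relation.Binary.Reasoning.Setoid ≈-setoid

  private
    p : ℕ
    p = suc k

  fermat : ∀ x → + (x ^ p) ≈ + x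
  fermat zero    = ≈-refl
  fermat (suc x) = begin
    + ((1 ℕ.+ x) ^ p)   ≈⟨ ≡[mod]⇒≈ ([1+x]^p≡1+x^p p-prime x) ⟩
    + (1 ℕ.+ x ^ p)     ≡⟨ pos-+ 1 (x ^ p) ⟩
    1ℤ + + (x ^ p)      ≈⟨ +-congˡ 1ℤ (fermat x) ⟩
    1ℤ + + x            ≡⟨ pos-+ 1 x ⟨
    + suc x             ∎

  fermat-unit : ∀ u → ¬ p ∣ u → ∃[ m ] u ^ k ≡ 1 ℕ.+ m ℕ.* p
  fermat-unit zero    p∤0 = ⊥-elim (p∤0 (p ∣0))
  fermat-unit (suc u) p∤u = ≈⇒≡+multiple u^k≈1 (ℕ.m^n>0 (suc u) k)
    where
      u^k≈1 : + (suc u ^ k) ≈ + 1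
      u^k≈1 = *-cancelˡ-≈ p-prime (+ suc u) (λ u≈0 → p∤u (∣⇒∣ᵤ (≈0⇒∣ u≈0))) (begin
        + suc u * + (suc u ^ k)   ≡⟨ pos-* (suc u) (suc u ^ k) ⟨
        + (suc u ^ p)             ≈⟨ fermat (suc u) ⟩
        + suc u                   ≡⟨ *-identityʳ (+ suc u) ⟨
        + suc u * + 1             ∎)

  ∤⇒∤+p : ∀ {u} → ¬ p ∣ u → ¬ p ∣ u ℕ.+ p
  ∤⇒∤+p {u} p∤u p∣u+p = p∤u (∣m+n∣m⇒∣n (subst (p ∣_) (ℕ.+-comm u p) p∣u+p) ∣-refl)

  q : ℕ → ℕ
  q = fermatQuotient p

  fermatQuotient-shift : ∀ u → ¬ p ∣ u → + u * (+ q (u ℕ.+ p) - + q u) ≈ - 1ℤ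
  fermatQuotient-shift u p∤u with fermat-unit u p∤u | fermat-unit (u ℕ.+ p) (∤⇒∤+p p∤u)
  ... | m , u^k≡ | m′ , [u+p]^k≡ = begin
    + u * (+ q (u ℕ.+ p) - + q u)           ≈⟨ *-congˡ (+ u) (+-cong q′≈m′ (-‿cong q≈m)) ⟩
    + u * (+ m′ - + m)                      ≡⟨ add-subtract-one (+ u) (+ m′) (+ m) ⟩
    (+ u * + m′ + 1ℤ) - 1ℤ - + u * + m      ≡⟨ cong₂ (λ a b → a - 1ℤ - b) (cast-+1 u m′) (pos-* u m) ⟨
    + (u ℕ.* m′ ℕ.+ 1) - 1ℤ - + (u ℕ.* m)   ≈⟨ +-congʳ (- + (u ℕ.* m)) (+-congʳ (- 1ℤ) (≡[mod]⇒≈ shift)) ⟩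
    + (u ℕ.* m) - 1ℤ - + (u ℕ.* m)          ≡⟨ cancel (+ (u ℕ.* m)) ⟩
    - 1ℤ                                    ∎
    where
      q≈m : + q u ≈ + m
      q≈m = ≈-sym (≡[mod]⇒≈ (exact-quotient≡fermatQuotient k u m p∤u u^k≡))
      q′≈m′ : + q (u ℕ.+ p) ≈ + m′
      q′≈m′ = ≈-sym (≡[mod]⇒≈ (exact-quotient≡fermatQuotient k (u ℕ.+ p) m′ (∤⇒∤+p p∤u) [u+p]^k≡))
      shift : (u ℕ.* m′ ℕ.+ 1) ≡ (u ℕ.* m) [mod p ]
      shift = exact-quotient-shift k u m m′ u^k≡ [u+p]^k≡
      cast-+1 : ∀ u m → + (u ℕ.* m ℕ.+ 1) ≡ + u * + m + 1ℤ
      cast-+1 u m = trans (pos-+ (u ℕ.* m) 1) (cong (_+ 1ℤ) (pos-* u m))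
      add-subtract-one : ∀ u a b → u * (a - b) ≡ (u * a + 1ℤ) - 1ℤ - u * b
      add-subtract-one = solve-∀
      cancel : ∀ a → a - 1ℤ - a ≡ - 1ℤ
      cancel = solve-∀

module PolynomialFunctions (p : ℕ) where
  open import Data.Nat as ℕ using (z≤n; s≤s)
  import Data.Nat.Properties as ℕ
  open import Data.Integer using (ℤ; +_; _+_; _*_; _-_; -_; 0ℤ; 1ℤ)
  open import Data.Integer.Properties using (+-identityˡ; +-identityʳ; +-assoc; pos-+; *-zeroʳ; -1*i≡-i)
  open import Data.Integer.Tactic.RingSolver
  open Modulo p
  open import Relation.Binary.Reasoning.Setoid ≈-setoid

  -- f agrees modulo p with a polynomial function of degree at most n.  Instead of
  -- coefficients we record the factor theorem: f x - f a = (x - a) g x with deg g < n.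
  Deg≤ : ℕ → (ℤ → ℤ) → Set
  Deg≤ zero    f = ∀ x y → f x ≈ f y
  Deg≤ (suc n) f = ∀ a → ∃[ g ] Deg≤ n g × (∀ x → f x ≈ f a + (x - a) * g x)

  private
    plus-zero : ∀ c y → c ≡ c + y * 0ℤ
    plus-zero = solve-∀

  Deg≤-resp : ∀ n {f g} → (∀ x → f x ≈ g x) → Deg≤ n f → Deg≤ n g
  Deg≤-resp zero    f≈g df x y = ≈-trans (≈-sym (f≈g x)) (≈-trans (df x y) (f≈g y))
  Deg≤-resp (suc n) {f} {g} f≈g df a with df a
  ... | h , dh , f≈ = h , dh , λ x → begin
    g x                   ≈⟨ f≈g x ⟨
    f x                   ≈⟨ f≈ x ⟩
    f a + (x - a) * h x   ≈⟨ +-congʳ ((x - a) * h x) (f≈g a) ⟩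
    g a + (x - a) * h x   ∎

  Deg≤-const : ∀ n c → Deg≤ n (λ _ → c)
  Deg≤-const zero    c x y = ≈-refl
  Deg≤-const (suc n) c a   = (λ _ → 0ℤ) , Deg≤-const n 0ℤ , λ x → ≈-reflexive (plus-zero c (x - a))

  Deg≤-suc : ∀ n {f} → Deg≤ n f → Deg≤ (suc n) f
  Deg≤-suc zero    {f} df a = (λ _ → 0ℤ) , Deg≤-const 0 0ℤ , λ x →
    ≈-trans (df x a) (≈-reflexive (plus-zero (f a) (x - a)))
  Deg≤-suc (suc n) df a with df a
  ... | g , dg , f≈ = g , Deg≤-suc n dg , f≈

  Deg≤-+ : ∀ n {f g} → Deg≤ n f → Deg≤ n g → Deg≤ n (λ x → f x + g x)
  Deg≤-+ zero    df dg x y = +-cong (df x y) (dg x y)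
  Deg≤-+ (suc n) {f} {g} df dg a with df a | dg a
  ... | f′ , df′ , f≈ | g′ , dg′ , g≈ = (λ x → f′ x + g′ x) , Deg≤-+ n df′ dg′ , λ x →
    ≈-trans (+-cong (f≈ x) (g≈ x)) (≈-reflexive (interchange (f a) (g a) (x - a) (f′ x) (g′ x)))
    where
      interchange : ∀ u v y s t → (u + y * s) + (v + y * t) ≡ (u + v) + y * (s + t)
      interchange = solve-∀

  Deg≤-scale : ∀ n c {f} → Deg≤ n f → Deg≤ n (λ x → c * f x)
  Deg≤-scale zero    c df x y = *-congˡ c (df x y)
  Deg≤-scale (suc n) c {f} df a with df a
  ... | g , dg , f≈ = (λ x → c * g x) , Deg≤-scale n c dg , λ x →
    ≈-trans (*-congˡ c (f≈ x)) (≈-reflexive (distrib c (f a) (x - a) (g x)))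
    where
      distrib : ∀ c u y v → c * (u + y * v) ≡ c * u + y * (c * v)
      distrib = solve-∀

  Deg≤-− : ∀ n {f g} → Deg≤ n f → Deg≤ n g → Deg≤ n (λ x → f x - g x)
  Deg≤-− n {f} {g} df dg =
    Deg≤-resp n (λ x → ≈-reflexive (cong (_+_ (f x)) (-1*i≡-i (g x)))) (Deg≤-+ n df (Deg≤-scale n (- 1ℤ) dg))

  Deg≤-linear-* : ∀ n b {f} → Deg≤ n f → Deg≤ (suc n) (λ x → (x + b) * f x)
  Deg≤-linear-* zero    b {f} df a = (λ _ → f a) , Deg≤-const 0 (f a) , λ x → begin
    (x + b) * f x                     ≈⟨ *-congˡ (x + b) (df x a) ⟩
    (x + b) * f a                     ≡⟨ split x a b (f a) ⟩
    (a + b) * f a + (x - a) * f a     ∎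
    where
      split : ∀ x a b c → (x + b) * c ≡ (a + b) * c + (x - a) * c
      split = solve-∀
  Deg≤-linear-* (suc n) b {f} df a with df a
  ... | h , dh , f≈ = g , dg , λ x → begin
    (x + b) * f x                                    ≡⟨ split x a b (f x) ⟩
    (x - a) * f x + (a + b) * f x                    ≈⟨ +-congˡ ((x - a) * f x) (*-congˡ (a + b) (f≈ x)) ⟩
    (x - a) * f x + (a + b) * (f a + (x - a) * h x)  ≡⟨ regroup x a b (f x) (f a) (h x) ⟩
    (a + b) * f a + (x - a) * g x                    ∎
    where
      g : ℤ → ℤ
      g x = f x + (a + b) * h x
      dg : Deg≤ (suc n) g
      dg = Deg≤-+ (suc n) df (Deg≤-scale (suc n) (a + b) (Deg≤-suc n dh))
      split : ∀ x a b c → (x + b) * c ≡ (x - a) * c + (a + b) * c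
      split = solve-∀
      regroup : ∀ x a b u v w → (x - a) * u + (a + b) * (v + (x - a) * w) ≡ (a + b) * v + (x - a) * (u + (a + b) * w)
      regroup = solve-∀

  Deg≤-rising : ∀ n → Deg≤ n (rising n)
  Deg≤-rising zero    = Deg≤-const 0 1ℤ
  Deg≤-rising (suc n) = Deg≤-linear-* n (+ n) (Deg≤-rising n)

  Deg≤-risingWithout : ∀ n i → i ℕ.≤ n → Deg≤ n (risingWithout (suc n) i)
  Deg≤-risingWithout n i i≤n with ℕ.m≤n⇒m<n∨m≡n i≤n
  ... | inj₂ refl = Deg≤-resp n (λ x → ≈-reflexive (sym (risingWithout-last n x))) (Deg≤-rising n)
  Deg≤-risingWithout (suc n) i _ | inj₁ i<1+n =
    Deg≤-resp (suc n) (λ x → ≈-reflexive (sym (risingWithout-suc-≢ (ℕ.>⇒≢ i<1+n) x)))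
      (Deg≤-linear-* n (+ suc n) (Deg≤-risingWithout n i (ℕ.≤-pred i<1+n)))

  Deg≤-linCombℤ : ∀ n c d {f : ℕ → ℤ → ℤ} → (∀ i → i ℕ.< n → Deg≤ d (f i)) →
                  Deg≤ d (λ x → linCombℤ n c (λ i → f i x))
  Deg≤-linCombℤ zero    c d df = Deg≤-const d 0ℤ
  Deg≤-linCombℤ (suc n) c d df = Deg≤-+ d (Deg≤-linCombℤ n c d (λ i i<n → df i (ℕ.m<n⇒m<1+n i<n)))
                                          (Deg≤-scale d (+ c n) (df n ℕ.≤-refl))

  module _ (p-prime : Prime p) where

    Deg≤-roots⇒≈0 : ∀ n {f} a → n ℕ.< p → Deg≤ n f →
                    (∀ i → i ℕ.≤ n → f (a + + i) ≈ 0ℤ) → ∀ x → f x ≈ 0ℤ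
    Deg≤-roots⇒≈0 zero    {f} a _   df roots x = ≈-trans (df x (a + + 0)) (roots 0 z≤n)
    Deg≤-roots⇒≈0 (suc n) {f} a n<p df roots x with df a
    ... | g , dg , f≈ = begin
      f x                  ≈⟨ f≈ x ⟩
      f a + (x - a) * g x  ≈⟨ +-cong fa≈0 (*-congˡ (x - a) (g≈0 x)) ⟩
      0ℤ + (x - a) * 0ℤ    ≡⟨ cong (_+_ 0ℤ) (*-zeroʳ (x - a)) ⟩
      0ℤ                   ∎
      where
        fa≈0 : f a ≈ 0ℤ
        fa≈0 = subst (λ y → f y ≈ 0ℤ) (+-identityʳ a) (roots 0 z≤n)
        shift : ∀ i → a + 1ℤ + + i ≡ a + + suc i
        shift i = trans (+-assoc a 1ℤ (+ i)) (cong (_+_ a) (sym (pos-+ 1 i)))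
        difference : ∀ a i → (a + 1ℤ + i) - a ≡ 1ℤ + i
        difference = solve-∀
        -- At the root y = a + 1 + i the factorisation reads (1 + i) g y ≈ 0, and 1 + i ≤ n < p.
        g-roots : ∀ i → i ℕ.≤ n → g (a + 1ℤ + + i) ≈ 0ℤ
        g-roots i i≤n = *-cancelˡ-≈ p-prime (+ suc i) 1+i≉0 (begin
          + suc i * g y         ≡⟨ cong (_* g y) (trans (pos-+ 1 i) (sym (difference a (+ i)))) ⟩
          (y - a) * g y         ≡⟨ +-identityˡ ((y - a) * g y) ⟨
          0ℤ + (y - a) * g y    ≈⟨ +-congʳ ((y - a) * g y) fa≈0 ⟨
          f a + (y - a) * g y   ≈⟨ f≈ y ⟨
          f y                   ≡⟨ cong f (shift i) ⟩
          f (a + + suc i)       ≈⟨ roots (suc i) (s≤s i≤n) ⟩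
          0ℤ                    ≡⟨ *-zeroʳ (+ suc i) ⟨
          + suc i * 0ℤ          ∎)
          where
            y : ℤ
            y = a + 1ℤ + + i
            1+i≉0 : ¬ + suc i ≈ 0ℤ
            1+i≉0 = positive<p⇒≉0 p-prime (s≤s z≤n) (ℕ.≤-<-trans (s≤s i≤n) n<p)
        g≈0 : ∀ x → g x ≈ 0ℤ
        g≈0 = Deg≤-roots⇒≈0 n (a + 1ℤ) (ℕ.<-trans (ℕ.n<1+n n) n<p) dg g-roots

import Data.Nat as ℕ

module NoShortRecurrence (k : ℕ) (p-prime : Prime (suc k)) {N L : ℕ}
                         (L-small : 2 ℕ.* L ℕ.< k) (N-large : 2 ℕ.* L ℕ.< N ℕ.∸ (suc k ℕ.+ 1)) where
  open import Data.Nat using (_≤_; _<_; _∸_; s≤s; z≤n)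
  import Data.Nat.Properties as ℕ
  open import Data.Nat.Divisibility using (∣⇒≤)
  open import Data.Nat.Tactic.RingSolver using (solve-∀)
  open import Data.Integer using (ℤ; +_; _+_; _*_; _-_; -_; 0ℤ; 1ℤ)
  open import Data.Integer.Properties using (pos-+; +-inverseʳ; +-identityʳ; *-identityʳ; *-zeroˡ)
  import Data.Integer.Tactic.RingSolver as ℤ
  open Modulo (suc k)
  open FermatQuotient k p-prime
  open PolynomialFunctions (suc k)

  private
    p : ℕ
    p = suc k

  root-bound : ∀ {i m} → i ≤ L → m ≤ L → suc i ℕ.+ m < p
  root-bound {i} {m} i≤L m≤L = s≤s (begin
    suc (i ℕ.+ m)   ≤⟨ s≤s (ℕ.+-mono-≤ i≤L m≤L) ⟩
    suc (L ℕ.+ L)   ≡⟨ cong suc (cong (L ℕ.+_) (sym (ℕ.+-identityʳ L))) ⟩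
    suc (2 ℕ.* L)   ≤⟨ L-small ⟩
    k               ∎)
    where open ℕ.≤-Reasoning

  L<p : L < p
  L<p = ℕ.≤-<-trans (ℕ.n≤1+n L) (root-bound z≤n ℕ.≤-refl)

  sequence-bound : ∀ {i} → i ≤ L → suc i ℕ.+ p ℕ.+ L < N
  sequence-bound {i} i≤L = begin-strict
    suc i ℕ.+ p ℕ.+ L             ≤⟨ ℕ.+-monoˡ-≤ L (ℕ.+-monoˡ-≤ p (s≤s i≤L)) ⟩
    suc L ℕ.+ p ℕ.+ L             <⟨ ℕ.n<1+n _ ⟩
    suc (suc L ℕ.+ p ℕ.+ L)       ≡⟨ rearrange L k ⟩
    suc (2 ℕ.* L) ℕ.+ (p ℕ.+ 1)   ≤⟨ ℕ.m≤o∸n⇒m+n≤o (suc (2 ℕ.* L)) p+1≤N N-large ⟩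
    N                             ∎
    where
      open ℕ.≤-Reasoning
      rearrange : ∀ L k → suc (suc L ℕ.+ suc k ℕ.+ L) ≡ suc (2 ℕ.* L) ℕ.+ (suc k ℕ.+ 1)
      rearrange = solve-∀
      p+1≤N : p ℕ.+ 1 ≤ N
      p+1≤N = ℕ.<⇒≤ (ℕ.m∸n≢0⇒n<m (ℕ.>⇒≢ (ℕ.≤-<-trans z≤n N-large)))

  open import Relation.Binary.Reasoning.Setoid ≈-setoid

  module _ (c : ℕ → ℕ) where

    -- With c L = -1 this is the numerator of ∑_{m ≤ L} c m / (x + m) over ∏_{m ≤ L} (x + m).
    numerator : ℤ → ℤ
    numerator x = risingWithout (suc L) L x - linCombℤ L c (λ m → risingWithout (suc L) m x)

    Deg≤-numerator : Deg≤ L numerator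
    Deg≤-numerator = Deg≤-− L (Deg≤-risingWithout L L ℕ.≤-refl)
                              (Deg≤-linCombℤ L c L (λ m m<L → Deg≤-risingWithout L m (ℕ.<⇒≤ m<L)))

    numerator-at-p∸L : ¬ numerator (+ (p ∸ L)) ≈ 0ℤ
    numerator-at-p∸L numerator≈0 = rising-≉0 p-prime L factor≉0 (begin
      rising L X                        ≡⟨ risingWithout-last L X ⟨
      risingWithout (suc L) L X         ≡⟨ +-identityʳ _ ⟨
      risingWithout (suc L) L X - 0ℤ    ≈⟨ +-congˡ (risingWithout (suc L) L X) (-‿cong others≈0) ⟨
      numerator X                       ≈⟨ numerator≈0 ⟩
      0ℤ                                ∎)
      where
        X : ℤ
        X = + (p ∸ L)
        X+L≈0 : X + + L ≈ 0ℤ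
        X+L≈0 = subst (_≈ 0ℤ) (trans (cong +_ (sym (ℕ.m∸n+n≡m (ℕ.<⇒≤ L<p)))) (pos-+ (p ∸ L) L)) p≈0
        others≈0 : linCombℤ L c (λ m → risingWithout (suc L) m X) ≈ 0ℤ
        others≈0 = ≈-trans (linCombℤ-cong L c (λ m m<L → begin
          risingWithout (suc L) m X        ≡⟨ risingWithout-suc-≢ (ℕ.>⇒≢ m<L) X ⟩
          (X + + L) * risingWithout L m X  ≈⟨ *-congʳ (risingWithout L m X) X+L≈0 ⟩
          0ℤ * risingWithout L m X         ≡⟨ *-zeroˡ (risingWithout L m X) ⟩
          0ℤ                               ∎)) (≈-reflexive (linCombℤ-0 L c))
        factor≉0 : ∀ m → m < L → ¬ X + + m ≈ 0ℤ
        factor≉0 m m<L = subst (λ y → ¬ y ≈ 0ℤ) (pos-+ (p ∸ L) m) (positive<p⇒≉0 p-prime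
          (ℕ.≤-trans (ℕ.m<n⇒0<n∸m L<p) (ℕ.m≤m+n _ m))
          (subst (p ∸ L ℕ.+ m <_) (ℕ.m∸n+n≡m (ℕ.<⇒≤ L<p)) (ℕ.+-monoʳ-< (p ∸ L) m<L)))

    module _ (recurrence : ∀ u → u ℕ.+ L < N → q (u ℕ.+ L) ≡ linComb L c q u [mod p ]) where

      recurrenceℤ : ∀ u → u ℕ.+ L < N → + q (u ℕ.+ L) ≈ linCombℤ L c (λ m → + q (u ℕ.+ m))
      recurrenceℤ u bound = ≈-trans (≡[mod]⇒≈ (recurrence u bound)) (≈-reflexive (+-linComb L c q u))

      numerator-root : ∀ i → i ≤ L → numerator (+ suc i) ≈ 0ℤ
      numerator-root i i≤L = begin
        numerator X                                        ≈⟨ +-congʳ (- others) (cleared L ℕ.≤-refl) ⟨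
        - F * (A L - B L) - others                         ≈⟨ +-congʳ (- others) (*-congˡ (- F) recurrence-difference) ⟩
        - F * (linCombℤ L c A - linCombℤ L c B) - others   ≡⟨ cong (_- others) (*-distribˡ-linCombℤ-− L c (- F) A B) ⟩
        linCombℤ L c (λ m → - F * (A m - B m)) - others    ≈⟨ +-congʳ (- others) (linCombℤ-cong L c cleared<L) ⟩
        others - others                                    ≡⟨ +-inverseʳ others ⟩
        0ℤ                                                 ∎
        where
          x : ℕ
          x = suc i
          X F others : ℤ
          X = + x
          F = rising (suc L) X
          others = linCombℤ L c (λ m → risingWithout (suc L) m X)
          A B : ℕ → ℤ
          A m = + q (x ℕ.+ p ℕ.+ m)
          B m = + q (x ℕ.+ m)
          recurrence-difference : A L - B L ≈ linCombℤ L c A - linCombℤ L c B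
          recurrence-difference =
            +-cong (recurrenceℤ (x ℕ.+ p) (sequence-bound i≤L)) (-‿cong (recurrenceℤ x x+L<N))
            where
              x+L<N : x ℕ.+ L < N
              x+L<N = ℕ.≤-<-trans (ℕ.+-monoˡ-≤ L (ℕ.m≤m+n x p)) (sequence-bound i≤L)
          swap-last : ∀ a b c → a ℕ.+ b ℕ.+ c ≡ a ℕ.+ c ℕ.+ b
          swap-last = solve-∀
          shift : ∀ m → m ≤ L → (X + + m) * (A m - B m) ≈ - 1ℤ
          shift m m≤L = subst₂ (λ y z → y * (+ q z - B m) ≈ - 1ℤ) (pos-+ x m) (swap-last x m p)
            (fermatQuotient-shift (x ℕ.+ m) (λ p∣x+m → ℕ.<⇒≱ (root-bound i≤L m≤L) (∣⇒≤ p∣x+m)))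
          regroup : ∀ r y d → - (r * y) * d ≡ r * - (y * d)
          regroup = ℤ.solve-∀
          cleared : ∀ m → m ≤ L → - F * (A m - B m) ≈ risingWithout (suc L) m X
          cleared m m≤L = begin
            - F * (A m - B m)                  ≡⟨ cong (λ y → - y * (A m - B m)) (risingWithout-* (s≤s m≤L) X) ⟨
            - (Fₘ * (X + + m)) * (A m - B m)   ≡⟨ regroup Fₘ (X + + m) (A m - B m) ⟩
            Fₘ * - ((X + + m) * (A m - B m))   ≈⟨ *-congˡ Fₘ (-‿cong (shift m m≤L)) ⟩
            Fₘ * - - 1ℤ                        ≡⟨ *-identityʳ Fₘ ⟩
            Fₘ                                 ∎
            where
              Fₘ : ℤ
              Fₘ = risingWithout (suc L) m X
          cleared<L : ∀ m → m < L → - F * (A m - B m) ≈ risingWithout (suc L) m X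
          cleared<L m m<L = cleared m (ℕ.<⇒≤ m<L)

  no-short-recurrence : ¬ HasLinRec p q N L
  no-short-recurrence (c , recurrence) =
    numerator-at-p∸L c (Deg≤-roots⇒≈0 p-prime L 1ℤ L<p (Deg≤-numerator c) roots (+ (p ∸ L)))
    where
      roots : ∀ i → i ≤ L → numerator c (1ℤ + + i) ≈ 0ℤ
      roots i i≤L = subst (λ y → numerator c y ≈ 0ℤ) (pos-+ 1 i) (numerator-root c recurrence i i≤L)

open import Data.Nat using (_+_; _*_; _∸_; _^_; _≤_; _<_; _⊓_; _≤?_)
open import Data.Nat.Properties using (≰⇒>; <-≤-trans; m⊓n≤m; m⊓n≤n)

theorem13 : (p N L : ℕ) → Prime p → 1 ≤ N → N < p ^ 2 →
    IsLinearComplexity p (fermatQuotient p) N L →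
    (p ∸ 1) ⊓ (N ∸ (p + 1)) ≤ 2 * L
theorem13 zero    N L p-prime _ _ _ = ⊥-elim (¬prime[0] p-prime)
theorem13 (suc k) N L p-prime _ _ (recurrence , _) with (suc k ∸ 1) ⊓ (N ∸ (suc k + 1)) ≤? 2 * L
... | yes bound = bound
... | no ¬bound = ⊥-elim (NoShortRecurrence.no-short-recurrence k p-prime
                           (<-≤-trans 2L<min (m⊓n≤m k _)) (<-≤-trans 2L<min (m⊓n≤n k _)) recurrence)
  where
    2L<min : 2 * L < k ⊓ (N ∸ (suc k + 1))
    2L<min = ≰⇒> ¬bound
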